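{- Let $m\ge 2$ and let $\Psi$ be a binary (2-)extracting procedure. For a symbol $x\in\{0,1,\dots,m-1\}$ and $1\le i\le m-1$ define $x^{(i)}=0$ if $x<i$, $x^{(i)}=1$ if $x=i$, and $x^{(i)}=\lambda$ (the empty string) if $x>i$; for $x=x_1\dots x_n$ let $x^{(i)}=x_1^{(i)}*\cdots*x_n^{(i)}$, where $*$ is concatenation. Then for each $n\ge 0$ the function $\Psi'\colon\{0,1,\dots,m-1\}^n\to\{0,1\}^*$ defined by \[ \Psi'(x)=\Psi(x^{(1)})*\cdots*\Psi(x^{(m-1)}) \] is $m$-extracting.
   Context: Consider i.i.d. draws from a source over $\{0,1,\dots,m-1\}$ with an arbitrary (unknown) distribution $\langle p_0,\dots,p_{m-1}\rangle$; a string $x\in\{0,\dots,m-1\}^n$ has probability $\prod_j p_j^{(\text{number of } j\text{'s in }x)}$. A function $f\colon\{0,1,\dots,m-1\}^n\to\{0,1\}^*$ is $m$-extracting if for every pair $z_1,z_2\in\{0,1\}^*$ with $|z_1|=|z_2|$ we have $\Pr(f(x)=z_1)=\Pr(f(x)=z_2)$, regardless of the distribution $\langle p_0,\dots,p_{m-1}\rangle$. A function $\Psi\colon\{0,\dots,m-1\}^*\to\{0,1\}^*$ is an $m$-extracting procedure if its restriction to $\{0,\dots,m-1\}^n$ is $m$-extracting for every $n\ge 0$; a binary extracting procedure is a 2-extracting procedure.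
   Formalization: The probabilities $p_0,\dots,p_{m-1}$ of the source distribution are taken to be rational. -}

module Defs where

open import Data.Nat using (ℕ; zero; suc; _∸_; _<?_)
open import Data.Fin using (Fin; toℕ) renaming (zero to fzero; suc to fsuc)
open import Data.Bool using (Bool)
import Data.Bool.Properties as BoolP
open import Data.List using (List; []; _∷_; map; foldr; concat; concatMap; length; upTo; allFin; filter)
open import Data.List.Properties using (≡-dec)
open import Data.Vec using (Vec; toList)
import Data.Vec as Vec
open import Data.Rational using (ℚ; 0ℚ; 1ℚ; _+_; _*_; _≤_)
open import Relation.Binary.PropositionalEquality using (_≡_)
open import Relation.Nullary using (Dec; yes; no)
open import Data.Nat.Properties using () renaming (_≟_ to _≟ℕ_)

allStrings : (m n : ℕ) → List (Vec (Fin m) n)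
allStrings m zero = Vec.[] ∷ []
allStrings m (suc n) = concatMap (λ a → map (a Vec.∷_) (allStrings m n)) (allFin m)

sumℚ : List ℚ → ℚ
sumℚ = foldr _+_ 0ℚ

prodℚ : List ℚ → ℚ
prodℚ = foldr _*_ 1ℚ

record IsDist (m : ℕ) (p : Fin m → ℚ) : Set where
  field
    nonneg : ∀ j → 0ℚ ≤ p j
    sums-to-one : sumℚ (map p (allFin m)) ≡ 1ℚ

-- probability of the string x: ∏_j p_j^(#j's in x) = ∏_k p(x_k)
strProb : ∀ {m n} → (Fin m → ℚ) → Vec (Fin m) n → ℚ
strProb p x = prodℚ (map p (toList x))

_≟bs_ : (u v : List Bool) → Dec (u ≡ v)
_≟bs_ = ≡-dec BoolP._≟_

-- Pr(f(x) = z) for x drawn i.i.d. of length n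
Pr : ∀ {m n} → (Fin m → ℚ) → (Vec (Fin m) n → List Bool) → List Bool → ℚ
Pr {m} {n} p f z = sumℚ (map (strProb p) (filter (λ x → f x ≟bs z) (allStrings m n)))

Extracting : (m n : ℕ) → (Vec (Fin m) n → List Bool) → Set
Extracting m n f = ∀ (p : Fin m → ℚ) → IsDist m p →
  ∀ (z₁ z₂ : List Bool) → length z₁ ≡ length z₂ → Pr p f z₁ ≡ Pr p f z₂

ExtractingProcedure : (m : ℕ) → (List (Fin m) → List Bool) → Set
ExtractingProcedure m Ψ = ∀ n → Extracting m n (λ x → Ψ (toList x))

BinaryExtractingProcedure : (List (Fin 2) → List Bool) → Set
BinaryExtractingProcedure = ExtractingProcedure 2

symProj : ∀ {m} → ℕ → Fin m → List (Fin 2)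
symProj i x with toℕ x <? i
... | yes _ = fzero ∷ []
... | no _ with toℕ x ≟ℕ i
...   | yes _ = fsuc fzero ∷ []
...   | no _ = []

strProj : ∀ {m} → ℕ → List (Fin m) → List (Fin 2)
strProj i = concatMap (symProj i)

Ψ′ : (m : ℕ) → (List (Fin 2) → List Bool) → List (Fin m) → List Bool
Ψ′ m Ψ x = concat (map (λ i → Ψ (strProj i x)) (map suc (upTo (m ∸ 1))))

{-# OPTIONS --safe #-}
-- Write a string x over {0,…,m-1} as merge y r, where y = x^(m-1) marks the occurrences of the top
-- symbol and r lists the other symbols in order. Then Ψ′(x) = Ψ′(r) * Ψ(y), and the weight of x is
-- p_{m-1}^(number of 1s in y) times the weight of r. Summing over the splittings z = a * b turns
-- Pr(Ψ′(x) = z) into a sum of terms Σ_y [Ψ(y) = b] h_a(number of 0s in y), where h_a depends on a only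
-- through |a| by induction on m. For a binary extracting Ψ such a sum depends on b only through |b|:
-- the number of y with k zeros and Ψ(y) = b is determined by |b|, as one sees by evaluating the
-- extracting property at a coin with Pr(0) = B·Pr(1) and reading off base-B digits.
module Submission where

open import Defs
open import Algebra.Bundles using (CommutativeSemiring; CommutativeRing)
import Algebra.Properties.Semiring.Mult
open import Data.Bool using (Bool; if_then_else_)
import Data.Bool.Properties as Boolₚ
open import Data.Fin using (Fin; zero; suc; toℕ; inject₁; fromℕ)
import Data.Fin.Properties as Finₚ
open import Data.List
  using (List; []; _∷_; [_]; _++_; _∷ʳ_; map; foldr; concat; concatMap; filter; length; upTo; allFin; tabulate)
open import Data.List.Properties using (≡-dec; map-upTo; upTo-∷ʳ; map-++; concat-++; ++-identityʳ; filter-none)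
import Data.List.Relation.Unary.All as All
open import Data.List.Relation.Unary.All using (All; []; _∷_)
open import Data.List.Relation.Unary.All.Properties using (all-upTo)
import Data.Nat as ℕ
open import Data.Nat using (ℕ; zero; suc; _<_; _≤_; s≤s; _∸_; _<?_)
import Data.Nat.Properties as ℕₚ
open import Data.Nat.DivMod using (_%_; [m+kn]%n≡m%n; m<n⇒m%n≡m)
open import Data.Product using (_×_; _,_; proj₁; proj₂; map₁)
open import Data.Rational using (ℚ; 0ℚ; 1ℚ; 1/_; Positive; NonNegative)
import Data.Rational.Properties as ℚₚ
open import Data.Vec using (Vec; []; _∷_; toList)
open import Function using (_∘_; id)
open import Relation.Binary.Definitions using (DecidableEquality; tri<; tri≈; tri>)
open import Relation.Binary.PropositionalEquality as ≡ using (_≡_; cong; cong₂; module ≡-Reasoning)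
open import Relation.Nullary using (Dec; does; yes; no; contradiction)
open import Relation.Unary using (Decidable)

private variable
  X Y : Set

splits : {A : Set} → List A → List (List A × List A)
splits []      = [ ([] , []) ]
splits (c ∷ z) = ([] , c ∷ z) ∷ map (map₁ (c ∷_)) (splits z)

module ListSum {c ℓ} (R : CommutativeSemiring c ℓ) where

  open CommutativeSemiring R hiding (zero)
  open import Algebra.Properties.CommutativeSemigroup +-commutativeSemigroup using (interchange)
  open import Algebra.Properties.CommutativeSemigroup *-commutativeSemigroup using (x∙yz≈y∙zx)
  open import Algebra.Properties.Monoid.Sum +-monoid using (sum; sum-init-last)
  open import Relation.Binary.Reasoning.Setoid setoid

  -- For ℚ this is literally sumℚ (map f xs) of Defs, so Pr unfolds to a ∑ over a filter.
  ∑ : List X → (X → Carrier) → Carrier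
  ∑ xs f = foldr _+_ 0# (map f xs)

  𝟙 : ∀ {p} {P : Set p} → Dec P → Carrier
  𝟙 P? = if does P? then 1# else 0#

  ∑-cong-All : ∀ {xs : List X} {f g : X → Carrier} → All (λ x → f x ≈ g x) xs → ∑ xs f ≈ ∑ xs g
  ∑-cong-All []         = refl
  ∑-cong-All (eq ∷ eqs) = +-cong eq (∑-cong-All eqs)

  ∑-cong : ∀ (xs : List X) {f g : X → Carrier} → (∀ x → f x ≈ g x) → ∑ xs f ≈ ∑ xs g
  ∑-cong xs eq = ∑-cong-All (All.universal eq xs)

  ∑-zero : ∀ (xs : List X) → ∑ xs (λ _ → 0#) ≈ 0#
  ∑-zero []       = refl
  ∑-zero (x ∷ xs) = trans (+-identityˡ _) (∑-zero xs)

  ∑-distrib-+ : ∀ (xs : List X) f g → ∑ xs (λ x → f x + g x) ≈ ∑ xs f + ∑ xs g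
  ∑-distrib-+ []       f g = sym (+-identityˡ 0#)
  ∑-distrib-+ (x ∷ xs) f g = trans (+-congˡ (∑-distrib-+ xs f g)) (interchange _ _ _ _)

  *-distribˡ-∑ : ∀ a (xs : List X) f → a * ∑ xs f ≈ ∑ xs (λ x → a * f x)
  *-distribˡ-∑ a []       f = zeroʳ a
  *-distribˡ-∑ a (x ∷ xs) f = trans (distribˡ a (f x) (∑ xs f)) (+-congˡ (*-distribˡ-∑ a xs f))

  *-distribʳ-∑ : ∀ a (xs : List X) f → ∑ xs f * a ≈ ∑ xs (λ x → f x * a)
  *-distribʳ-∑ a []       f = zeroˡ a
  *-distribʳ-∑ a (x ∷ xs) f = trans (distribʳ a (f x) (∑ xs f)) (+-congˡ (*-distribʳ-∑ a xs f))

  ∑-++ : ∀ (xs ys : List X) f → ∑ (xs ++ ys) f ≈ ∑ xs f + ∑ ys f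
  ∑-++ []       ys f = sym (+-identityˡ _)
  ∑-++ (x ∷ xs) ys f = trans (+-congˡ (∑-++ xs ys f)) (sym (+-assoc _ _ _))

  ∑-map : ∀ (g : X → Y) xs f → ∑ (map g xs) f ≡ ∑ xs (f ∘ g)
  ∑-map g []       f = ≡.refl
  ∑-map g (x ∷ xs) f = cong (f (g x) +_) (∑-map g xs f)

  ∑-concatMap : ∀ (g : X → List Y) xs f → ∑ (concatMap g xs) f ≈ ∑ xs (λ x → ∑ (g x) f)
  ∑-concatMap g []       f = refl
  ∑-concatMap g (x ∷ xs) f = trans (∑-++ (g x) (concatMap g xs) f) (+-congˡ (∑-concatMap g xs f))

  ∑-comm : ∀ (xs : List X) (ys : List Y) (f : X → Y → Carrier) →
           ∑ xs (λ x → ∑ ys (f x)) ≈ ∑ ys (λ y → ∑ xs (λ x → f x y))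
  ∑-comm []       ys f = sym (∑-zero ys)
  ∑-comm (x ∷ xs) ys f =
    trans (+-congˡ (∑-comm xs ys f)) (sym (∑-distrib-+ ys (f x) (λ y → ∑ xs (λ x′ → f x′ y))))

  ∑-filter : ∀ {P : X → Set} (P? : Decidable P) xs f → ∑ (filter P? xs) f ≈ ∑ xs (λ x → 𝟙 (P? x) * f x)
  ∑-filter P? []       f = refl
  ∑-filter P? (x ∷ xs) f with P? x
  ... | yes _ = +-cong (sym (*-identityˡ (f x))) (∑-filter P? xs f)
  ... | no  _ = trans (∑-filter P? xs f) (sym (trans (+-congʳ (zeroˡ (f x))) (+-identityˡ _)))

  ∑-tabulate : ∀ {n} (g : Fin n → X) f → ∑ (tabulate g) f ≡ sum (f ∘ g)
  ∑-tabulate {n = zero}  g f = ≡.refl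
  ∑-tabulate {n = suc n} g f = cong (f (g zero) +_) (∑-tabulate (g ∘ suc) f)

  ∑-allFin-last : ∀ K (f : Fin (suc K) → Carrier) →
                  ∑ (allFin (suc K)) f ≈ ∑ (allFin K) (f ∘ inject₁) + f (fromℕ K)
  ∑-allFin-last K f = begin
    ∑ (allFin (suc K)) f                   ≡⟨ ∑-tabulate id f ⟩
    sum f                                  ≈⟨ sum-init-last f ⟩
    sum (f ∘ inject₁) + f (fromℕ K)        ≡⟨ cong (_+ f (fromℕ K)) (∑-tabulate id (f ∘ inject₁)) ⟨
    ∑ (allFin K) (f ∘ inject₁) + f (fromℕ K) ∎

  ∑-upTo-suc : ∀ n (f : ℕ → Carrier) → ∑ (upTo (suc n)) f ≡ f 0 + ∑ (upTo n) (f ∘ suc)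
  ∑-upTo-suc n f =
    cong (f 0 +_) (≡.trans (cong (λ ks → ∑ ks f) (≡.sym (map-upTo suc n))) (∑-map suc (upTo n) f))

  -- does (suc j ≟ suc k) computes to does (j ≟ k), so shifting the range needs no rewriting.
  ∑-upTo-𝟙 : ∀ {n j} → j < n → (h : ℕ → Carrier) → ∑ (upTo n) (λ k → 𝟙 (j ℕₚ.≟ k) * h k) ≈ h j
  ∑-upTo-𝟙 {suc n} {zero} _ h = begin
    ∑ (upTo (suc n)) (λ k → 𝟙 (0 ℕₚ.≟ k) * h k)
      ≡⟨ ∑-upTo-suc n _ ⟩
    1# * h 0 + ∑ (upTo n) (λ k → 0# * h (suc k))
      ≈⟨ +-cong (*-identityˡ _) (trans (∑-cong (upTo n) (λ _ → zeroˡ _)) (∑-zero (upTo n))) ⟩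
    h 0 + 0#
      ≈⟨ +-identityʳ _ ⟩
    h 0 ∎
  ∑-upTo-𝟙 {suc n} {suc j} (s≤s j<n) h = begin
    ∑ (upTo (suc n)) (λ k → 𝟙 (suc j ℕₚ.≟ k) * h k)
      ≡⟨ ∑-upTo-suc n _ ⟩
    0# * h 0 + ∑ (upTo n) (λ k → 𝟙 (j ℕₚ.≟ k) * h (suc k))
      ≈⟨ +-cong (zeroˡ _) (∑-upTo-𝟙 j<n (h ∘ suc)) ⟩
    0# + h (suc j)
      ≈⟨ +-identityˡ _ ⟩
    h (suc j) ∎

  ∑-fibres : ∀ n (g : X → ℕ) → (∀ x → g x < n) → ∀ xs (w : X → Carrier) (h : ℕ → Carrier) →
             ∑ xs (λ x → w x * h (g x)) ≈ ∑ (upTo n) (λ k → h k * ∑ xs (λ x → w x * 𝟙 (g x ℕₚ.≟ k)))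
  ∑-fibres n g g<n xs w h = sym (begin
    ∑ (upTo n) (λ k → h k * ∑ xs (λ x → w x * 𝟙 (g x ℕₚ.≟ k)))
      ≈⟨ ∑-cong (upTo n) (λ k → *-distribˡ-∑ (h k) xs _) ⟩
    ∑ (upTo n) (λ k → ∑ xs (λ x → h k * (w x * 𝟙 (g x ℕₚ.≟ k))))
      ≈⟨ ∑-comm (upTo n) xs (λ k x → h k * (w x * 𝟙 (g x ℕₚ.≟ k))) ⟩
    ∑ xs (λ x → ∑ (upTo n) (λ k → h k * (w x * 𝟙 (g x ℕₚ.≟ k))))
      ≈⟨ ∑-cong xs (λ x → trans (∑-cong (upTo n) (λ k → x∙yz≈y∙zx (h k) (w x) _))
                                (sym (*-distribˡ-∑ (w x) (upTo n) _))) ⟩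
    ∑ xs (λ x → w x * ∑ (upTo n) (λ k → 𝟙 (g x ℕₚ.≟ k) * h k))
      ≈⟨ ∑-cong xs (λ x → *-congˡ (∑-upTo-𝟙 (g<n x) h)) ⟩
    ∑ xs (λ x → w x * h (g x)) ∎)

  ∑-splits-cong : ∀ {A : Set} {Φ Φ′ : List A × List A → Carrier} →
    (∀ {a a′ b b′} → length a ≡ length a′ → length b ≡ length b′ → Φ (a , b) ≈ Φ′ (a′ , b′)) →
    ∀ {z z′} → length z ≡ length z′ → ∑ (splits z) Φ ≈ ∑ (splits z′) Φ′
  ∑-splits-cong resp {[]}    {[]}     _  = +-congʳ (resp ≡.refl ≡.refl)
  ∑-splits-cong {Φ = Φ} {Φ′} resp {c ∷ z} {c′ ∷ z′} eq = +-cong (resp ≡.refl eq) (begin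
    ∑ (map (map₁ (c ∷_)) (splits z)) Φ
      ≡⟨ ∑-map _ (splits z) Φ ⟩
    ∑ (splits z) (Φ ∘ map₁ (c ∷_))
      ≈⟨ ∑-splits-cong {Φ = Φ ∘ map₁ (c ∷_)} {Φ′ ∘ map₁ (c′ ∷_)} (λ ea eb → resp (cong suc ea) eb)
                       {z} {z′} (ℕₚ.suc-injective eq) ⟩
    ∑ (splits z′) (Φ′ ∘ map₁ (c′ ∷_))
      ≡⟨ ∑-map _ (splits z′) Φ′ ⟨
    ∑ (map (map₁ (c′ ∷_)) (splits z′)) Φ′ ∎)

  module _ {A : Set} (_≟_ : DecidableEquality A) where

    private
      _≟ₗ_ : DecidableEquality (List A)
      _≟ₗ_ = ≡-dec _≟_

    𝟙-∷ : ∀ x c (u v : List A) → 𝟙 ((x ∷ u) ≟ₗ (c ∷ v)) ≈ 𝟙 (x ≟ c) * 𝟙 (u ≟ₗ v)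
    𝟙-∷ x c u v with x ≟ c
    ... | yes _ = sym (*-identityˡ _)
    ... | no  _ = sym (zeroˡ _)

    𝟙-++ : ∀ (u v z : List A) →
           𝟙 ((u ++ v) ≟ₗ z) ≈ ∑ (splits z) (λ (a , b) → 𝟙 (u ≟ₗ a) * 𝟙 (v ≟ₗ b))
    𝟙-++ []      v []      = sym (trans (+-identityʳ _) (*-identityˡ _))
    𝟙-++ []      v (c ∷ z) = sym (begin
      1# * 𝟙 (v ≟ₗ (c ∷ z))
        + ∑ (map (map₁ (c ∷_)) (splits z)) (λ (a , b) → 𝟙 ([] ≟ₗ a) * 𝟙 (v ≟ₗ b))
        ≡⟨ cong (1# * 𝟙 (v ≟ₗ (c ∷ z)) +_) (∑-map (map₁ (c ∷_)) (splits z) _) ⟩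
      1# * 𝟙 (v ≟ₗ (c ∷ z)) + ∑ (splits z) (λ (_ , b) → 0# * 𝟙 (v ≟ₗ b))
        ≈⟨ +-cong (*-identityˡ _) (trans (∑-cong (splits z) (λ _ → zeroˡ _)) (∑-zero (splits z))) ⟩
      𝟙 (v ≟ₗ (c ∷ z)) + 0#
        ≈⟨ +-identityʳ _ ⟩
      𝟙 (v ≟ₗ (c ∷ z)) ∎)
    𝟙-++ (x ∷ u) v []      = sym (trans (+-identityʳ _) (zeroˡ _))
    𝟙-++ (x ∷ u) v (c ∷ z) = begin
      𝟙 ((x ∷ u ++ v) ≟ₗ (c ∷ z))
        ≈⟨ 𝟙-∷ x c (u ++ v) z ⟩
      𝟙 (x ≟ c) * 𝟙 ((u ++ v) ≟ₗ z)
        ≈⟨ *-congˡ (𝟙-++ u v z) ⟩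
      𝟙 (x ≟ c) * ∑ (splits z) (λ (a , b) → 𝟙 (u ≟ₗ a) * 𝟙 (v ≟ₗ b))
        ≈⟨ *-distribˡ-∑ _ (splits z) _ ⟩
      ∑ (splits z) (λ (a , b) → 𝟙 (x ≟ c) * (𝟙 (u ≟ₗ a) * 𝟙 (v ≟ₗ b)))
        ≈⟨ ∑-cong (splits z) (λ (a , b) → trans (sym (*-assoc _ _ _)) (*-congʳ (sym (𝟙-∷ x c u a)))) ⟩
      ∑ (splits z) (λ (a , b) → 𝟙 ((x ∷ u) ≟ₗ (c ∷ a)) * 𝟙 (v ≟ₗ b))
        ≡⟨ ∑-map (map₁ (c ∷_)) (splits z) _ ⟨
      ∑ (map (map₁ (c ∷_)) (splits z)) (λ (a , b) → 𝟙 ((x ∷ u) ≟ₗ a) * 𝟙 (v ≟ₗ b))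
        ≈⟨ trans (+-congʳ (zeroˡ _)) (+-identityˡ _) ⟨
      0# * 𝟙 (v ≟ₗ (c ∷ z))
        + ∑ (map (map₁ (c ∷_)) (splits z)) (λ (a , b) → 𝟙 ((x ∷ u) ≟ₗ a) * 𝟙 (v ≟ₗ b))
        ∎

module FromℕSum {c ℓ} (R : CommutativeSemiring c ℓ) where

  open CommutativeSemiring R hiding (zero)
  open ListSum R
  open import Algebra.Definitions.RawSemiring rawSemiring using (_^_)
  private
    module ℕ∑ = ListSum ℕₚ.+-*-commutativeSemiring
    module Mult = Algebra.Properties.Semiring.Mult semiring

  cast : ℕ → Carrier
  cast n = n Mult.× 1#

  cast-∑ : ∀ (xs : List X) f → cast (ℕ∑.∑ xs f) ≈ ∑ xs (cast ∘ f)
  cast-∑ []       f = refl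
  cast-∑ (x ∷ xs) f = trans (Mult.×-homo-+ 1# (f x) _) (+-congˡ (cast-∑ xs f))

  cast-* : ∀ m n → cast (m ℕ.* n) ≈ cast m * cast n
  cast-* = Mult.×1-homo-*

  cast-𝟙 : ∀ {p} {P : Set p} (P? : Dec P) → cast (ℕ∑.𝟙 P?) ≈ 𝟙 P?
  cast-𝟙 (yes _) = +-identityʳ 1#
  cast-𝟙 (no _)  = refl

  cast-^ : ∀ m k → cast (m ℕ.^ k) ≈ cast m ^ k
  cast-^ m zero    = +-identityʳ 1#
  cast-^ m (suc k) = trans (cast-* m (m ℕ.^ k)) (*-congˡ (cast-^ m k))

zeros : ∀ {n} → Vec (Fin 2) n → ℕ
zeros []          = 0
zeros (zero  ∷ y) = suc (zeros y)
zeros (suc _ ∷ y) = zeros y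

zeros≤length : ∀ {n} (y : Vec (Fin 2) n) → zeros y ≤ n
zeros≤length []          = ℕ.z≤n
zeros≤length (zero  ∷ y) = s≤s (zeros≤length y)
zeros≤length (suc _ ∷ y) = ℕₚ.m≤n⇒m≤1+n (zeros≤length y)

merge : ∀ {K n} (y : Vec (Fin 2) n) → Vec (Fin K) (zeros y) → Vec (Fin (suc K)) n
merge         []          []      = []
merge         (zero  ∷ y) (c ∷ r) = inject₁ c ∷ merge y r
merge {K = K} (suc _ ∷ y) r       = fromℕ K ∷ merge y r

module MergeSum {c ℓ} (R : CommutativeSemiring c ℓ) where

  open CommutativeSemiring R hiding (zero)
  open ListSum R
  open import Relation.Binary.Reasoning.Setoid setoid

  ∑-allStrings-suc : ∀ m n (F : Vec (Fin m) (suc n) → Carrier) →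
    ∑ (allStrings m (suc n)) F ≈ ∑ (allFin m) (λ a → ∑ (allStrings m n) (λ v → F (a ∷ v)))
  ∑-allStrings-suc m n F =
    trans (∑-concatMap _ (allFin m) F) (∑-cong (allFin m) (λ a → reflexive (∑-map (a ∷_) (allStrings m n) F)))

  ∑-merge : ∀ K n (F : Vec (Fin (suc K)) n → Carrier) →
    ∑ (allStrings (suc K) n) F ≈ ∑ (allStrings 2 n) (λ y → ∑ (allStrings K (zeros y)) (λ r → F (merge y r)))
  ∑-merge K zero    F = sym (+-identityʳ _)
  ∑-merge K (suc n) F = begin
    ∑ (allStrings (suc K) (suc n)) F
      ≈⟨ ∑-allStrings-suc (suc K) n F ⟩
    ∑ (allFin (suc K)) (λ a → ∑ Sₙ (λ v → F (a ∷ v)))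
      ≈⟨ ∑-allFin-last K _ ⟩
    ∑ (allFin K) (λ c → ∑ Sₙ (λ v → F (inject₁ c ∷ v))) + ∑ Sₙ (λ v → F (fromℕ K ∷ v))
      ≈⟨ +-cong (∑-cong (allFin K) (λ c → ∑-merge K n _)) (∑-merge K n _) ⟩
    ∑ (allFin K) (λ c → ∑ S₂ (λ y → ∑ (Sᵣ y) (λ r → G (zero ∷ y) (c ∷ r)))) + ∑ S₂ (λ y → ∑ (Sᵣ y) (G (suc zero ∷ y)))
      ≈⟨ +-congʳ (∑-comm (allFin K) S₂ _) ⟩
    ∑ S₂ (λ y → ∑ (allFin K) (λ c → ∑ (Sᵣ y) (λ r → G (zero ∷ y) (c ∷ r)))) + ∑ S₂ (λ y → ∑ (Sᵣ y) (G (suc zero ∷ y)))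
      ≈⟨ +-congʳ (∑-cong S₂ (λ y → ∑-allStrings-suc K (zeros y) (G (zero ∷ y)))) ⟨
    ∑ S₂ (λ y → ∑ (Sᵣ (zero ∷ y)) (G (zero ∷ y))) + ∑ S₂ (λ y → ∑ (Sᵣ (suc zero ∷ y)) (G (suc zero ∷ y)))
      ≈⟨ trans (∑-allStrings-suc 2 n _) (+-congˡ (+-identityʳ _)) ⟨
    ∑ (allStrings 2 (suc n)) (λ y → ∑ (Sᵣ y) (G y)) ∎
    where
    Sₙ = allStrings (suc K) n
    S₂ = allStrings 2 n
    Sᵣ : ∀ {l} (y : Vec (Fin 2) l) → List (Vec (Fin K) (zeros y))
    Sᵣ y = allStrings K (zeros y)
    G : (y : Vec (Fin 2) (suc n)) → Vec (Fin K) (zeros y) → Carrier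
    G y r = F (merge y r)

open ≡ using (_≢_; refl; sym; trans)

private module ℕ∑ = ListSum ℕₚ.+-*-commutativeSemiring

𝟙≤1 : ∀ {p} {P : Set p} (P? : Dec P) → ℕ∑.𝟙 P? ≤ 1
𝟙≤1 (yes _) = ℕₚ.≤-refl
𝟙≤1 (no _)  = ℕ.z≤n

∑≤length : ∀ (xs : List X) f → (∀ x → f x ≤ 1) → ℕ∑.∑ xs f ≤ length xs
∑≤length []       f f≤1 = ℕ.z≤n
∑≤length (x ∷ xs) f f≤1 = ℕₚ.+-mono-≤ (f≤1 x) (∑≤length xs f f≤1)

divMod-unique : ∀ {B a a′ c c′} → a < B → a′ < B → a ℕ.+ B ℕ.* c ≡ a′ ℕ.+ B ℕ.* c′ → a ≡ a′ × c ≡ c′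
divMod-unique {suc b} {a} {a′} {c} {c′} a<B a′<B eq =
  a≡a′ , ℕₚ.*-cancelˡ-≡ c c′ (suc b) (ℕₚ.+-cancelˡ-≡ a _ _ (trans eq (cong (ℕ._+ suc b ℕ.* c′) (sym a≡a′))))
  where
  remainder : ∀ {x} y → x < suc b → (x ℕ.+ suc b ℕ.* y) % suc b ≡ x
  remainder {x} y x<B = trans (cong (λ t → (x ℕ.+ t) % suc b) (ℕₚ.*-comm (suc b) y))
                              (trans ([m+kn]%n≡m%n x y (suc b)) (m<n⇒m%n≡m x<B))
  a≡a′ = trans (sym (remainder c a<B)) (trans (cong (_% suc b) eq) (remainder c′ a′<B))

digits-suc : ∀ B L (d : ℕ → ℕ) →
  ℕ∑.∑ (upTo (suc L)) (λ k → B ℕ.^ k ℕ.* d k) ≡ d 0 ℕ.+ B ℕ.* ℕ∑.∑ (upTo L) (λ k → B ℕ.^ k ℕ.* d (suc k))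
digits-suc B L d = trans (ℕ∑.∑-upTo-suc L _) (cong₂ ℕ._+_ (ℕₚ.*-identityˡ (d 0))
  (trans (ℕ∑.∑-cong (upTo L) (λ k → ℕₚ.*-assoc B (B ℕ.^ k) (d (suc k))))
         (sym (ℕ∑.*-distribˡ-∑ B (upTo L) _))))

digits-unique : ∀ {B} L (d e : ℕ → ℕ) → (∀ k → d k < B) → (∀ k → e k < B) →
  ℕ∑.∑ (upTo L) (λ k → B ℕ.^ k ℕ.* d k) ≡ ℕ∑.∑ (upTo L) (λ k → B ℕ.^ k ℕ.* e k) →
  ∀ {k} → k < L → d k ≡ e k
digits-unique {B} (suc L) d e d<B e<B eq {k} = digit k
  where
  lowest-and-rest = divMod-unique (d<B 0) (e<B 0) (trans (sym (digits-suc B L d)) (trans eq (digits-suc B L e)))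
  digit : ∀ k → k < suc L → d k ≡ e k
  digit zero    _         = proj₁ lowest-and-rest
  digit (suc k) (s≤s k<L) =
    digits-unique L (d ∘ suc) (e ∘ suc) (d<B ∘ suc) (e<B ∘ suc) (proj₂ lowest-and-rest) k<L

symProj-< : ∀ {m} i (x : Fin m) → toℕ x < i → symProj i x ≡ zero ∷ []
symProj-< i x x<i with toℕ x <? i
... | yes _   = refl
... | no x≮i = contradiction x<i x≮i

symProj-≡ : ∀ {m} i (x : Fin m) → toℕ x ≡ i → symProj i x ≡ suc zero ∷ []
symProj-≡ i x x≡i with toℕ x <? i
... | yes x<i = contradiction x≡i (ℕₚ.<⇒≢ x<i)
... | no _ with toℕ x ℕₚ.≟ i
...   | yes _   = refl
...   | no x≢i = contradiction x≡i x≢i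

symProj-> : ∀ {m} i (x : Fin m) → i < toℕ x → symProj i x ≡ []
symProj-> i x i<x with toℕ x <? i
... | yes x<i = contradiction x<i (ℕₚ.<-asym i<x)
... | no _ with toℕ x ℕₚ.≟ i
...   | yes x≡i = contradiction (sym x≡i) (ℕₚ.<⇒≢ i<x)
...   | no _    = refl

symProj-cong : ∀ {m m′} i (x : Fin m) (x′ : Fin m′) → toℕ x ≡ toℕ x′ → symProj i x ≡ symProj i x′
symProj-cong i x x′ eq with ℕₚ.<-cmp (toℕ x) i
... | tri< x<i _ _ = trans (symProj-< i x x<i) (sym (symProj-< i x′ (≡.subst (_< i) eq x<i)))
... | tri≈ _ x≡i _ = trans (symProj-≡ i x x≡i) (sym (symProj-≡ i x′ (trans (sym eq) x≡i)))
... | tri> _ _ i<x = trans (symProj-> i x i<x) (sym (symProj-> i x′ (≡.subst (i <_) eq i<x)))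

strProj-merge-top : ∀ {K n} (y : Vec (Fin 2) n) (r : Vec (Fin K) (zeros y)) →
  strProj K (toList (merge y r)) ≡ toList y
strProj-merge-top []               []      = refl
strProj-merge-top {K} (zero ∷ y)   (c ∷ r) =
  cong₂ _++_ (symProj-< K (inject₁ c) (≡.subst (_< K) (sym (Finₚ.toℕ-inject₁ c)) (Finₚ.toℕ<n c)))
             (strProj-merge-top y r)
strProj-merge-top {K} (suc zero ∷ y) r     =
  cong₂ _++_ (symProj-≡ K (fromℕ K) (Finₚ.toℕ-fromℕ K)) (strProj-merge-top y r)

strProj-merge-below : ∀ {K n i} → i < K → (y : Vec (Fin 2) n) (r : Vec (Fin K) (zeros y)) →
  strProj i (toList (merge y r)) ≡ strProj i (toList r)
strProj-merge-below         i<K []          []      = refl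
strProj-merge-below {i = i} i<K (zero  ∷ y) (c ∷ r) =
  cong₂ _++_ (symProj-cong i (inject₁ c) c (Finₚ.toℕ-inject₁ c)) (strProj-merge-below i<K y r)
strProj-merge-below {K} {i = i} i<K (suc _ ∷ y) r   =
  cong₂ _++_ (symProj-> i (fromℕ K) (≡.subst (_ <_) (sym (Finₚ.toℕ-fromℕ K)) i<K))
             (strProj-merge-below i<K y r)

-- Ψ′ m Ψ is outputsUpTo Ψ (m ∸ 1); here the alphabet of x is decoupled from the number of projections.
outputsUpTo : ∀ {m} → (List (Fin 2) → List Bool) → ℕ → List (Fin m) → List Bool
outputsUpTo Ψ k x = concat (map (λ i → Ψ (strProj i x)) (map suc (upTo k)))

outputsUpTo-suc : ∀ {m} Ψ k (x : List (Fin m)) →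
  outputsUpTo Ψ (suc k) x ≡ outputsUpTo Ψ k x ++ Ψ (strProj (suc k) x)
outputsUpTo-suc Ψ k x = begin
  concat (map g (map suc (upTo (suc k))))            ≡⟨ cong (concat ∘ map g ∘ map suc) (upTo-∷ʳ k) ⟨
  concat (map g (map suc (upTo k ∷ʳ k)))             ≡⟨ cong (concat ∘ map g) (map-++ suc (upTo k) [ k ]) ⟩
  concat (map g (map suc (upTo k) ++ [ suc k ]))     ≡⟨ cong concat (map-++ g (map suc (upTo k)) [ suc k ]) ⟩
  concat (map g (map suc (upTo k)) ++ [ g (suc k) ]) ≡⟨ concat-++ (map g (map suc (upTo k))) [ g (suc k) ] ⟨
  outputsUpTo Ψ k x ++ (g (suc k) ++ [])             ≡⟨ cong (outputsUpTo Ψ k x ++_) (++-identityʳ (g (suc k))) ⟩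
  outputsUpTo Ψ k x ++ g (suc k)                     ∎
  where
  open ≡-Reasoning
  g = λ i → Ψ (strProj i x)

outputsUpTo-cong : ∀ {m m′} Ψ k (x : List (Fin m)) (x′ : List (Fin m′)) →
  (∀ {i} → i < k → strProj (suc i) x ≡ strProj (suc i) x′) → outputsUpTo Ψ k x ≡ outputsUpTo Ψ k x′
outputsUpTo-cong Ψ zero    x x′ _  = refl
outputsUpTo-cong Ψ (suc k) x x′ eq = begin
  outputsUpTo Ψ (suc k) x                      ≡⟨ outputsUpTo-suc Ψ k x ⟩
  outputsUpTo Ψ k x ++ Ψ (strProj (suc k) x)   ≡⟨ cong₂ (λ o s → o ++ Ψ s) (outputsUpTo-cong Ψ k x x′ (eq ∘ ℕₚ.m<n⇒m<1+n))
                                                                             (eq (ℕₚ.n<1+n k)) ⟩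
  outputsUpTo Ψ k x′ ++ Ψ (strProj (suc k) x′) ≡⟨ outputsUpTo-suc Ψ k x′ ⟨
  outputsUpTo Ψ (suc k) x′                     ∎
  where open ≡-Reasoning

Ψ′-merge : ∀ {K n} Ψ (y : Vec (Fin 2) n) (r : Vec (Fin (suc K)) (zeros y)) →
  Ψ′ (suc (suc K)) Ψ (toList (merge y r)) ≡ Ψ′ (suc K) Ψ (toList r) ++ Ψ (toList y)
Ψ′-merge {K} Ψ y r = trans (outputsUpTo-suc Ψ K (toList (merge y r)))
  (cong₂ _++_ (outputsUpTo-cong Ψ K (toList (merge y r)) (toList r) (λ i<K → strProj-merge-below (s≤s i<K) y r))
              (cong Ψ (strProj-merge-top y r)))

ℚ-semiring : CommutativeSemiring _ _
ℚ-semiring = CommutativeRing.commutativeSemiring ℚₚ.+-*-commutativeRing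

open ListSum ℚ-semiring
open MergeSum ℚ-semiring
open FromℕSum ℚ-semiring
open import Data.Rational using (_+_; _*_) renaming (_≤_ to _ℚ≤_)
open import Algebra.Definitions.RawSemiring (CommutativeSemiring.rawSemiring ℚ-semiring) using (_^_)
open import Algebra.Properties.CommutativeSemigroup (CommutativeSemiring.*-commutativeSemigroup ℚ-semiring)
  using (interchange; x∙yz≈y∙xz; xy∙z≈y∙xz)
open import Algebra.Properties.Group ℚₚ.+-0-group using () renaming (∙-cancelˡ to +-cancelˡ)

LengthInvariant : {A : Set} → (List Bool → A) → Set
LengthInvariant g = ∀ z₁ z₂ → length z₁ ≡ length z₂ → g z₁ ≡ g z₂

Pr-∑ : ∀ {m n} (p : Fin m → ℚ) (f : Vec (Fin m) n → List Bool) z →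
  Pr p f z ≡ ∑ (allStrings m n) (λ x → 𝟙 (f x ≟bs z) * strProb p x)
Pr-∑ {m} {n} p f z = ∑-filter (λ x → f x ≟bs z) (allStrings m n) (strProb p)

Pr-unreachable : ∀ {m n} (p : Fin m → ℚ) (f : Vec (Fin m) n → List Bool) z →
                 (∀ x → f x ≢ z) → Pr p f z ≡ 0ℚ
Pr-unreachable {m} {n} p f z f≢z =
  cong (sumℚ ∘ map (strProb p)) (filter-none (λ x → f x ≟bs z) (All.universal f≢z (allStrings m n)))

strProb-merge : ∀ {K n} (p : Fin (suc K) → ℚ) (y : Vec (Fin 2) n) (r : Vec (Fin K) (zeros y)) →
  strProb p (merge y r) ≡ p (fromℕ K) ^ (n ∸ zeros y) * strProb (p ∘ inject₁) r
strProb-merge p []         []      = sym (ℚₚ.*-identityˡ 1ℚ)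
strProb-merge {K} {suc n} p (zero ∷ y) (c ∷ r) = trans (cong (p (inject₁ c) *_) (strProb-merge p y r))
  (x∙yz≈y∙xz (p (inject₁ c)) (p (fromℕ K) ^ (n ∸ zeros y)) (strProb (p ∘ inject₁) r))
strProb-merge {K} {suc n} p (suc _ ∷ y) r = begin
  t * strProb p (merge y r)            ≡⟨ cong (t *_) (strProb-merge p y r) ⟩
  t * (t ^ (n ∸ zeros y) * w)          ≡⟨ ℚₚ.*-assoc t _ w ⟨
  t ^ suc (n ∸ zeros y) * w            ≡⟨ cong (λ e → t ^ e * w) (ℕₚ.+-∸-assoc 1 (zeros≤length y)) ⟨
  t ^ (suc n ∸ zeros y) * w            ∎
  where
  open ≡-Reasoning
  t = p (fromℕ K)
  w = strProb (p ∘ inject₁) r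

Pr-Ψ′-split : ∀ Ψ {K n} (p : Fin (suc (suc K)) → ℚ) z →
  Pr {n = n} p (λ x → Ψ′ (suc (suc K)) Ψ (toList x)) z ≡
  ∑ (splits z) (λ (a , b) → ∑ (allStrings 2 n) (λ y →
    𝟙 (Ψ (toList y) ≟bs b) *
    (p (fromℕ (suc K)) ^ (n ∸ zeros y) * Pr {n = zeros y} (p ∘ inject₁) (λ r → Ψ′ (suc K) Ψ (toList r)) a)))
Pr-Ψ′-split Ψ {K} {n} p z = begin
  Pr p Ψ′ₓ z
    ≡⟨ Pr-∑ p Ψ′ₓ z ⟩
  ∑ (allStrings (suc (suc K)) n) (λ x → 𝟙 (Ψ′ₓ x ≟bs z) * strProb p x)
    ≡⟨ ∑-merge (suc K) n _ ⟩
  ∑ S₂ (λ y → ∑ (Sᵣ y) (λ r → 𝟙 (Ψ′ₓ (merge y r) ≟bs z) * strProb p (merge y r)))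
    ≡⟨ ∑-cong S₂ (λ y → ∑-cong (Sᵣ y) (term-split y)) ⟩
  ∑ S₂ (λ y → ∑ (Sᵣ y) (λ r → ∑ (splits z) (λ s → G s y r)))
    ≡⟨ ∑-cong S₂ (λ y → ∑-comm (Sᵣ y) (splits z) (λ r s → G s y r)) ⟩
  ∑ S₂ (λ y → ∑ (splits z) (λ s → ∑ (Sᵣ y) (G s y)))
    ≡⟨ ∑-comm S₂ (splits z) (λ y s → ∑ (Sᵣ y) (G s y)) ⟩
  ∑ (splits z) (λ s → ∑ S₂ (λ y → ∑ (Sᵣ y) (G s y)))
    ≡⟨ ∑-cong (splits z) (λ s → ∑-cong S₂ (factor s)) ⟩
  ∑ (splits z) (λ (a , b) → ∑ S₂ (λ y → 𝟙 (Ψ (toList y) ≟bs b) * (tᵧ y * Pr {n = zeros y} p′ Ψ′ᵣ a))) ∎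
  where
  open ≡-Reasoning
  S₂ = allStrings 2 n
  Sᵣ : (y : Vec (Fin 2) n) → List (Vec (Fin (suc K)) (zeros y))
  Sᵣ y = allStrings (suc K) (zeros y)
  Ψ′ₓ : Vec (Fin (suc (suc K))) n → List Bool
  Ψ′ₓ x = Ψ′ (suc (suc K)) Ψ (toList x)
  Ψ′ᵣ : ∀ {L} → Vec (Fin (suc K)) L → List Bool
  Ψ′ᵣ r = Ψ′ (suc K) Ψ (toList r)
  p′ = p ∘ inject₁
  tᵧ : Vec (Fin 2) n → ℚ
  tᵧ y = p (fromℕ (suc K)) ^ (n ∸ zeros y)

  G : List Bool × List Bool → (y : Vec (Fin 2) n) → Vec (Fin (suc K)) (zeros y) → ℚ
  G (a , b) y r = 𝟙 (Ψ (toList y) ≟bs b) * (tᵧ y * (𝟙 (Ψ′ᵣ r ≟bs a) * strProb p′ r))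

  rearrange : ∀ a b c d → (a * b) * (c * d) ≡ b * (c * (a * d))
  rearrange a b c d = trans (xy∙z≈y∙xz a b (c * d)) (cong (b *_) (x∙yz≈y∙xz a c d))

  term-split : ∀ y r → 𝟙 (Ψ′ₓ (merge y r) ≟bs z) * strProb p (merge y r) ≡ ∑ (splits z) (λ s → G s y r)
  term-split y r = begin
    𝟙 (Ψ′ₓ (merge y r) ≟bs z) * strProb p (merge y r)
      ≡⟨ cong₂ (λ o w → 𝟙 (o ≟bs z) * w) (Ψ′-merge Ψ y r) (strProb-merge p y r) ⟩
    𝟙 ((Ψ′ᵣ r ++ Ψ (toList y)) ≟bs z) * (tᵧ y * strProb p′ r)
      ≡⟨ cong (_* (tᵧ y * strProb p′ r)) (𝟙-++ Boolₚ._≟_ (Ψ′ᵣ r) (Ψ (toList y)) z) ⟩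
    ∑ (splits z) (λ (a , b) → 𝟙 (Ψ′ᵣ r ≟bs a) * 𝟙 (Ψ (toList y) ≟bs b)) * (tᵧ y * strProb p′ r)
      ≡⟨ *-distribʳ-∑ _ (splits z) _ ⟩
    ∑ (splits z) (λ (a , b) → (𝟙 (Ψ′ᵣ r ≟bs a) * 𝟙 (Ψ (toList y) ≟bs b)) * (tᵧ y * strProb p′ r))
      ≡⟨ ∑-cong (splits z) (λ (a , b) → rearrange (𝟙 (Ψ′ᵣ r ≟bs a)) (𝟙 (Ψ (toList y) ≟bs b)) (tᵧ y) (strProb p′ r)) ⟩
    ∑ (splits z) (λ s → G s y r) ∎

  factor : ∀ s y → ∑ (Sᵣ y) (G s y) ≡ 𝟙 (Ψ (toList y) ≟bs proj₂ s) * (tᵧ y * Pr {n = zeros y} p′ Ψ′ᵣ (proj₁ s))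
  factor (a , b) y = begin
    ∑ (Sᵣ y) (λ r → 𝟙ᵦ * (tᵧ y * (𝟙 (Ψ′ᵣ r ≟bs a) * strProb p′ r)))
      ≡⟨ *-distribˡ-∑ 𝟙ᵦ (Sᵣ y) _ ⟨
    𝟙ᵦ * ∑ (Sᵣ y) (λ r → tᵧ y * (𝟙 (Ψ′ᵣ r ≟bs a) * strProb p′ r))
      ≡⟨ cong (𝟙ᵦ *_) (*-distribˡ-∑ (tᵧ y) (Sᵣ y) _) ⟨
    𝟙ᵦ * (tᵧ y * ∑ (Sᵣ y) (λ r → 𝟙 (Ψ′ᵣ r ≟bs a) * strProb p′ r))
      ≡⟨ cong (λ P → 𝟙ᵦ * (tᵧ y * P)) (Pr-∑ {n = zeros y} p′ Ψ′ᵣ a) ⟨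
    𝟙ᵦ * (tᵧ y * Pr {n = zeros y} p′ Ψ′ᵣ a) ∎
    where 𝟙ᵦ = 𝟙 (Ψ (toList y) ≟bs b)

ExtractingForZeroCountWeights : (List (Fin 2) → List Bool) → Set
ExtractingForZeroCountWeights Ψ = ∀ n (h : ℕ → ℚ) →
  LengthInvariant (λ β → ∑ (allStrings 2 n) (λ y → 𝟙 (Ψ (toList y) ≟bs β) * h (zeros y)))

Ψ′-lengthInvariant : ∀ Ψ → ExtractingForZeroCountWeights Ψ → ∀ K n (p : Fin (suc K) → ℚ) →
  LengthInvariant (Pr {n = n} p (λ x → Ψ′ (suc K) Ψ (toList x)))
Ψ′-lengthInvariant Ψ Ψ-weights zero    n p []      []      _ = refl
Ψ′-lengthInvariant Ψ Ψ-weights zero    n p (_ ∷ _) (_ ∷ _) _ =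
  trans (Pr-unreachable {n = n} p _ _ (λ _ ())) (sym (Pr-unreachable {n = n} p _ _ (λ _ ())))
Ψ′-lengthInvariant Ψ Ψ-weights (suc K) n p z z′ |z|≡|z′| = begin
  Pr p Ψ′ₓ z      ≡⟨ Pr-Ψ′-split Ψ {n = n} p z ⟩
  ∑ (splits z) Φ  ≡⟨ ∑-splits-cong {Φ = Φ} {Φ} Φ-resp {z} {z′} |z|≡|z′| ⟩
  ∑ (splits z′) Φ ≡⟨ Pr-Ψ′-split Ψ {n = n} p z′ ⟨
  Pr p Ψ′ₓ z′     ∎
  where
  open ≡-Reasoning
  Ψ′ₓ : Vec (Fin (suc (suc K))) n → List Bool
  Ψ′ₓ x = Ψ′ (suc (suc K)) Ψ (toList x)

  weight : List Bool → ℕ → ℚ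
  weight a L = p (fromℕ (suc K)) ^ (n ∸ L) * Pr {n = L} (p ∘ inject₁) (λ r → Ψ′ (suc K) Ψ (toList r)) a

  Φ : List Bool × List Bool → ℚ
  Φ (a , b) = ∑ (allStrings 2 n) (λ y → 𝟙 (Ψ (toList y) ≟bs b) * weight a (zeros y))

  Φ-resp : ∀ {a a′ b b′} → length a ≡ length a′ → length b ≡ length b′ → Φ (a , b) ≡ Φ (a′ , b′)
  Φ-resp {a} {a′} {b} {b′} |a|≡|a′| |b|≡|b′| = begin
    Φ (a , b)   ≡⟨ ∑-cong (allStrings 2 n) (λ y → cong (𝟙 (Ψ (toList y) ≟bs b) *_) (weight-resp (zeros y))) ⟩
    Φ (a′ , b)  ≡⟨ Ψ-weights n (weight a′) b b′ |b|≡|b′| ⟩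
    Φ (a′ , b′) ∎
    where
    weight-resp : ∀ L → weight a L ≡ weight a′ L
    weight-resp L = cong (p (fromℕ (suc K)) ^ (n ∸ L) *_) (Ψ′-lengthInvariant Ψ Ψ-weights K L (p ∘ inject₁) a a′ |a|≡|a′|)

cast-suc-positive : ∀ n → Positive (cast (suc n))
cast-suc-positive zero    = _
cast-suc-positive (suc n) = ℚₚ.pos+pos⇒pos 1ℚ (cast (suc n)) {{cast-suc-positive n}}

cast-nonNegative : ∀ n → NonNegative (cast n)
cast-nonNegative zero    = _
cast-nonNegative (suc n) = ℚₚ.pos⇒nonNeg (cast (suc n)) {{cast-suc-positive n}}

cast-injective : ∀ {m n} → cast m ≡ cast n → m ≡ n
cast-injective {zero}  {zero}  _  = refl
cast-injective {zero}  {suc n} eq = contradiction eq (ℚₚ.<⇒≢ (ℚₚ.positive⁻¹ _ {{cast-suc-positive n}}))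
cast-injective {suc m} {zero}  eq = contradiction (sym eq) (ℚₚ.<⇒≢ (ℚₚ.positive⁻¹ _ {{cast-suc-positive m}}))
cast-injective {suc m} {suc n} eq = cong suc (cast-injective (+-cancelˡ 1ℚ (cast m) (cast n) eq))

^-positive : ∀ r .{{_ : Positive r}} n → Positive (r ^ n)
^-positive r zero    = _
^-positive r (suc n) = ℚₚ.pos*pos⇒pos r (r ^ n) {{^-positive r n}}

*-cancelˡ-positive : ∀ r .{{_ : Positive r}} {p q} → r * p ≡ r * q → p ≡ q
*-cancelˡ-positive r eq =
  ℚₚ.≤-antisym (ℚₚ.*-cancelˡ-≤-pos r (ℚₚ.≤-reflexive eq)) (ℚₚ.*-cancelˡ-≤-pos r (ℚₚ.≤-reflexive (sym eq)))

coin₁ : ℕ → ℚ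
coin₁ B = (1/ cast (suc B)) {{ℚₚ.pos⇒nonZero (cast (suc B)) {{cast-suc-positive B}}}}

coin₁-positive : ∀ B → Positive (coin₁ B)
coin₁-positive B = ℚₚ.1/pos⇒pos (cast (suc B)) {{cast-suc-positive B}}

coin : ℕ → Fin 2 → ℚ
coin B zero    = cast B * coin₁ B
coin B (suc _) = coin₁ B

coin-isDist : ∀ B → IsDist 2 (coin B)
coin-isDist B = record { nonneg = nonneg ; sums-to-one = sums-to-one }
  where
  open ≡-Reasoning
  c = coin₁ B
  c-nonNegative : NonNegative c
  c-nonNegative = ℚₚ.pos⇒nonNeg c {{coin₁-positive B}}
  nonneg : ∀ j → 0ℚ ℚ≤ coin B j
  nonneg zero    = ℚₚ.nonNegative⁻¹ _ {{ℚₚ.nonNeg*nonNeg⇒nonNeg (cast B) {{cast-nonNegative B}} c {{c-nonNegative}}}}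
  nonneg (suc _) = ℚₚ.nonNegative⁻¹ c {{c-nonNegative}}
  sums-to-one : cast B * c + (c + 0ℚ) ≡ 1ℚ
  sums-to-one = begin
    cast B * c + (c + 0ℚ) ≡⟨ cong (cast B * c +_) (ℚₚ.+-identityʳ c) ⟩
    cast B * c + c        ≡⟨ ℚₚ.+-comm (cast B * c) c ⟩
    c + cast B * c        ≡⟨ cong (_+ cast B * c) (ℚₚ.*-identityˡ c) ⟨
    1ℚ * c + cast B * c   ≡⟨ ℚₚ.*-distribʳ-+ c 1ℚ (cast B) ⟨
    cast (suc B) * c      ≡⟨ ℚₚ.*-inverseʳ (cast (suc B)) {{ℚₚ.pos⇒nonZero (cast (suc B)) {{cast-suc-positive B}}}} ⟩
    1ℚ                    ∎

strProb-coin : ∀ B {n} (y : Vec (Fin 2) n) → strProb (coin B) y ≡ coin₁ B ^ n * cast B ^ zeros y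
strProb-coin B []          = sym (ℚₚ.*-identityˡ 1ℚ)
strProb-coin B {suc n} (zero ∷ y) = begin
  (cast B * c) * strProb (coin B) y       ≡⟨ cong ((cast B * c) *_) (strProb-coin B y) ⟩
  (cast B * c) * (c ^ n * cast B ^ zeros y) ≡⟨ cong (_* (c ^ n * cast B ^ zeros y)) (ℚₚ.*-comm (cast B) c) ⟩
  (c * cast B) * (c ^ n * cast B ^ zeros y) ≡⟨ interchange c (cast B) (c ^ n) (cast B ^ zeros y) ⟩
  (c * c ^ n) * (cast B * cast B ^ zeros y) ∎
  where
  open ≡-Reasoning
  c = coin₁ B
strProb-coin B {suc n} (suc _ ∷ y) =
  trans (cong (coin₁ B *_) (strProb-coin B y)) (sym (ℚₚ.*-assoc (coin₁ B) (coin₁ B ^ n) (cast B ^ zeros y)))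

Pr-coin : ∀ (Ψ : List (Fin 2) → List Bool) B n β →
  Pr {n = n} (coin B) (λ y → Ψ (toList y)) β ≡
  coin₁ B ^ n * cast (ℕ∑.∑ (allStrings 2 n) (λ y → ℕ∑.𝟙 (Ψ (toList y) ≟bs β) ℕ.* B ℕ.^ zeros y))
Pr-coin Ψ B n β = begin
  Pr {n = n} (coin B) (λ y → Ψ (toList y)) β
    ≡⟨ Pr-∑ {n = n} (coin B) (λ y → Ψ (toList y)) β ⟩
  ∑ S₂ (λ y → 𝟙 (Ψ (toList y) ≟bs β) * strProb (coin B) y)
    ≡⟨ ∑-cong S₂ (λ y → trans (cong (𝟙 (Ψ (toList y) ≟bs β) *_) (strProb-coin B y))
                                 (x∙yz≈y∙xz (𝟙 (Ψ (toList y) ≟bs β)) (coin₁ B ^ n) (cast B ^ zeros y))) ⟩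
  ∑ S₂ (λ y → coin₁ B ^ n * (𝟙 (Ψ (toList y) ≟bs β) * cast B ^ zeros y))
    ≡⟨ *-distribˡ-∑ (coin₁ B ^ n) S₂ _ ⟨
  coin₁ B ^ n * ∑ S₂ (λ y → 𝟙 (Ψ (toList y) ≟bs β) * cast B ^ zeros y)
    ≡⟨ cong (coin₁ B ^ n *_) cast-weights ⟨
  coin₁ B ^ n * cast (ℕ∑.∑ S₂ (λ y → ℕ∑.𝟙 (Ψ (toList y) ≟bs β) ℕ.* B ℕ.^ zeros y)) ∎
  where
  open ≡-Reasoning
  S₂ = allStrings 2 n
  cast-weights : cast (ℕ∑.∑ S₂ (λ y → ℕ∑.𝟙 (Ψ (toList y) ≟bs β) ℕ.* B ℕ.^ zeros y)) ≡
                 ∑ S₂ (λ y → 𝟙 (Ψ (toList y) ≟bs β) * cast B ^ zeros y)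
  cast-weights = trans (cast-∑ S₂ _) (∑-cong S₂ (λ y →
    trans (cast-* (ℕ∑.𝟙 (Ψ (toList y) ≟bs β)) (B ℕ.^ zeros y))
          (cong₂ _*_ (cast-𝟙 (Ψ (toList y) ≟bs β)) (cast-^ B (zeros y)))))

fibreCount : (List (Fin 2) → List Bool) → ℕ → List Bool → ℕ → ℕ
fibreCount Ψ n β k = ℕ∑.∑ (allStrings 2 n) (λ y → ℕ∑.𝟙 (Ψ (toList y) ≟bs β) ℕ.* ℕ∑.𝟙 (zeros y ℕₚ.≟ k))

fibreCount≤ : ∀ Ψ n β k → fibreCount Ψ n β k ≤ length (allStrings 2 n)
fibreCount≤ Ψ n β k =
  ∑≤length (allStrings 2 n) _ (λ y → ℕₚ.*-mono-≤ (𝟙≤1 (Ψ (toList y) ≟bs β)) (𝟙≤1 (zeros y ℕₚ.≟ k)))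

cast-fibreCount : ∀ Ψ n β k →
  cast (fibreCount Ψ n β k) ≡ ∑ (allStrings 2 n) (λ y → 𝟙 (Ψ (toList y) ≟bs β) * 𝟙 (zeros y ℕₚ.≟ k))
cast-fibreCount Ψ n β k =
  trans (cast-∑ (allStrings 2 n) _) (∑-cong (allStrings 2 n) (λ y →
    trans (cast-* (ℕ∑.𝟙 (Ψ (toList y) ≟bs β)) (ℕ∑.𝟙 (zeros y ℕₚ.≟ k)))
          (cong₂ _*_ (cast-𝟙 (Ψ (toList y) ≟bs β)) (cast-𝟙 (zeros y ℕₚ.≟ k)))))

-- Under coin B, Pr(Ψ(y) = β) is a fixed multiple of the number whose base-B digits are the
-- fibre counts of β, and B exceeds every fibre count.
fibreCount-lengthInvariant : ∀ Ψ → BinaryExtractingProcedure Ψ → ∀ n {k} → k < suc n →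
  LengthInvariant (λ β → fibreCount Ψ n β k)
fibreCount-lengthInvariant Ψ Ψ-ext n k<1+n β β′ |β|≡|β′| =
  digits-unique (suc n) (fibreCount Ψ n β) (fibreCount Ψ n β′) (digit<B β) (digit<B β′) digits-equal k<1+n
  where
  B = suc (length (allStrings 2 n))
  digit<B : ∀ β k → fibreCount Ψ n β k < B
  digit<B β k = s≤s (fibreCount≤ Ψ n β k)
  weighted : List Bool → ℕ
  weighted β = ℕ∑.∑ (allStrings 2 n) (λ y → ℕ∑.𝟙 (Ψ (toList y) ≟bs β) ℕ.* B ℕ.^ zeros y)
  weighted-equal : weighted β ≡ weighted β′
  weighted-equal = cast-injective (*-cancelˡ-positive (coin₁ B ^ n) {{^-positive (coin₁ B) {{coin₁-positive B}} n}}
    (trans (sym (Pr-coin Ψ B n β)) (trans (Ψ-ext n (coin B) (coin-isDist B) β β′ |β|≡|β′|) (Pr-coin Ψ B n β′))))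
  fibres : ∀ β → weighted β ≡ ℕ∑.∑ (upTo (suc n)) (λ k → B ℕ.^ k ℕ.* fibreCount Ψ n β k)
  fibres β = ℕ∑.∑-fibres (suc n) zeros (λ y → s≤s (zeros≤length y)) (allStrings 2 n)
                         (λ y → ℕ∑.𝟙 (Ψ (toList y) ≟bs β)) (B ℕ.^_)
  digits-equal = trans (sym (fibres β)) (trans weighted-equal (fibres β′))

binary⇒zeroCountWeights : ∀ Ψ → BinaryExtractingProcedure Ψ → ExtractingForZeroCountWeights Ψ
binary⇒zeroCountWeights Ψ Ψ-ext n h β β′ |β|≡|β′| = begin
  ∑ S₂ (λ y → 𝟙 (Ψ (toList y) ≟bs β) * h (zeros y))   ≡⟨ fibres β ⟩
  ∑ (upTo (suc n)) (λ k → h k * count β k)           ≡⟨ ∑-cong-All (All.map (cong (h _ *_) ∘ count-equal) (all-upTo (suc n))) ⟩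
  ∑ (upTo (suc n)) (λ k → h k * count β′ k)          ≡⟨ fibres β′ ⟨
  ∑ S₂ (λ y → 𝟙 (Ψ (toList y) ≟bs β′) * h (zeros y))  ∎
  where
  open ≡-Reasoning
  S₂ = allStrings 2 n
  count : List Bool → ℕ → ℚ
  count β k = ∑ S₂ (λ y → 𝟙 (Ψ (toList y) ≟bs β) * 𝟙 (zeros y ℕₚ.≟ k))
  fibres : ∀ β → ∑ S₂ (λ y → 𝟙 (Ψ (toList y) ≟bs β) * h (zeros y)) ≡ ∑ (upTo (suc n)) (λ k → h k * count β k)
  fibres β = ∑-fibres (suc n) zeros (λ y → s≤s (zeros≤length y)) S₂ (λ y → 𝟙 (Ψ (toList y) ≟bs β)) h
  count-equal : ∀ {k} → k < suc n → count β k ≡ count β′ k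
  count-equal {k} k<1+n = begin
    count β k                  ≡⟨ cast-fibreCount Ψ n β k ⟨
    cast (fibreCount Ψ n β k)  ≡⟨ cong cast (fibreCount-lengthInvariant Ψ Ψ-ext n k<1+n β β′ |β|≡|β′|) ⟩
    cast (fibreCount Ψ n β′ k) ≡⟨ cast-fibreCount Ψ n β′ k ⟩
    count β′ k                 ∎

theorem1 : (m : ℕ) → 2 ≤ m → (Ψ : List (Fin 2) → List Bool) →
    BinaryExtractingProcedure Ψ →
    (n : ℕ) → Extracting m n (λ x → Ψ′ m Ψ (toList x))
theorem1 (suc (suc K)) (s≤s (s≤s _)) Ψ Ψ-extracting n p _ =
  Ψ′-lengthInvariant Ψ (binary⇒zeroCountWeights Ψ Ψ-extracting) (suc K) n p
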